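{- There exist absolute constants $C>0$ and $n_0$ such that the following holds for all integers $n\geq n_0$ and $t\geq 2$. Let $k$ be an integer with $|q|\leq tn^{2/3}$, where $q=\frac{(t-1)n}{2}-k$, and let $p=p(k,n)\geq 0$ be the unique real number with $\mu(p)=k/n$. Then $$|1-p|\leq C\cdot\frac{|q|}{t^2 n}.$$
   Context: For real $p\geq 0$ let $Z(p)=\sum_{j=0}^{t-1}p^j$ and $\mu(p)=\frac{1}{Z(p)}\sum_{j=0}^{t-1}j\,p^j$. The function $\mu$ is continuous and strictly increasing on $[0,\infty)$ with $\mu(0)=0$, $\mu(1)=\frac{t-1}{2}$ and $\mu(p)\to t-1$ as $p\to\infty$, so for $0\leq k/n<t-1$ there is a unique $p\geq 0$ with $\mu(p)=k/n$. -}

module Defs where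

open import Data.Nat using (ℕ; zero; suc)
open import Data.Integer using (ℤ; +_)
open import Data.Rational using (ℚ; _+_; _*_; 0ℚ; 1ℚ; _/_)

ιℤ : ℤ → ℚ
ιℤ z = z / 1

ιℕ : ℕ → ℚ
ιℕ m = (+ m) / 1

pow : ℚ → ℕ → ℚ
pow p zero    = 1ℚ
pow p (suc j) = p * pow p j

sumBelow : ℕ → (ℕ → ℚ) → ℚ
sumBelow zero    f = 0ℚ
sumBelow (suc m) f = sumBelow m f + f m

Z : ℕ → ℚ → ℚ
Z t p = sumBelow t (λ j → pow p j)

-- M(p) = Σ_{j=0}^{t-1} j p^j ,  so that μ(p) = M(p) / Z(p)
M : ℕ → ℚ → ℚ
M t p = sumBelow t (λ j → ιℕ j * pow p j)

-- Since Z(p) ≥ 1 > 0 for p ≥ 0 and n > 0: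
--   μ(p) ≤ k/n  ⇔  n·M(p) ≤ k·Z(p)

open import Data.Rational using (_-_; _≤_; ½)

qval : ℕ → ℕ → ℤ → ℚ
qval t n k = (ιℕ t - 1ℚ) * ιℕ n * ½ - ιℤ k

-- μ(p) ≤ k/n   (cross-multiplied by n·Z(p) > 0)
μ≤ : ℕ → ℕ → ℤ → ℚ → Set
μ≤ t n k p = ιℕ n * M t p ≤ ιℤ k * Z t p

μ≥ : ℕ → ℕ → ℤ → ℚ → Set
μ≥ t n k p = ιℤ k * Z t p ≤ ιℕ n * M t p

{-# OPTIONS --safe #-}
-- Put W t r = Σ_{j<t} (j+1) rʲ = M + Z and P t r = Σ_{j<t} W j r = Σ_{j<t} (j+1)(t-1-j) rʲ.
-- Both have nonnegative coefficients and 2M - (t-1)Z = (r-1)P, so μ(r) ≤ k/n gives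
-- n (r-1) P ≤ 2|q| Z and μ(r) ≥ k/n gives n (1-r) P ≤ 2|q| Z.  By induction on t ≥ 2,
-- separately for r ≥ 1 and r ≤ 1, t² Z ≤ 8 (1 + |r-1| t) P.  Combining the two on the
-- nontrivial side gives |r-1| t² n ≤ 16 |q| (1 + |r-1| t), and |q|³ ≤ t³ n² with n ≥ 32³
-- gives 32 |q| ≤ n t, which absorbs the second term: |r-1| t² n ≤ 32 |q|.
module Submission where

open import Defs
open import Data.Nat using (ℕ) renaming (_≥_ to _≥ℕ_)
open import Data.Integer using (ℤ)
open import Data.Product using (Σ; _×_)
open import Data.Rational using (ℚ; _≤_; _<_; _*_; _-_; ∣_∣; 0ℚ; 1ℚ)

open import Agda.Builtin.FromNat using (Number; fromNat)
open import Data.Empty using (⊥-elim)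
import Data.Integer as ℤ
import Data.Integer.Tactic.RingSolver as ℤ-Solver
open import Data.List.Base using (_∷_; [])
open import Data.Nat as ℕ using (zero; suc)
import Data.Nat.Literals as ℕ-Literals
open import Data.Nat.Properties using (m+[n∸m]≡n)
open import Data.Product using (_,_)
open import Data.Rational using (_+_; -_; ½; _≤?_; positive; nonNegative; toℚᵘ)
import Data.Rational.Literals as ℚ-Literals
open import Data.Rational.Properties
  using ( module ≤-Reasoning; _≟_; +-*-commutativeRing
        ; ≤-refl; ≤-reflexive; ≤-trans; ≤-total; <-≤-trans; ≤-<-trans; <-irrefl; ≰⇒>; <⇒≤
        ; +-identityʳ; +-inverseʳ; *-identityʳ; *-zeroʳ; *-assoc
        ; +-mono-≤; +-monoʳ-≤; +-monoˡ-≤; +-monoʳ-<; +-monoˡ-<; +-mono-<-≤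
        ; *-monoˡ-≤-nonNeg; *-cancelʳ-≤-pos; pos*pos⇒pos; positive⁻¹; nonNegative⁻¹; normalize-nonNeg
        ; 0≤∣p∣; 0≤p⇒∣p∣≡p; ∣-p∣≡∣p∣; toℚᵘ-injective; toℚᵘ-fromℚᵘ; toℚᵘ-homo-+ )
open import Data.Rational.Unnormalised as ℚᵘ using (mkℚᵘ; *≡*)
open import Data.Rational.Unnormalised.Properties as ℚᵘ using (module ≃-Reasoning)
open import Data.Sum using (inj₁; inj₂)
open import Data.Unit.Base using (tt)
open import Level using (0ℓ)
open import Relation.Binary.PropositionalEquality using (_≡_; refl; sym; trans; cong; cong₂; subst; subst₂)
open import Relation.Nullary.Decidable using (yes; no; dec⇒maybe)
open import Tactic.RingSolver using (solve)
open import Tactic.RingSolver.Core.AlmostCommutativeRing using (AlmostCommutativeRing; fromCommutativeRing)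

instance
  ℕ-number : Number ℕ
  ℕ-number = ℕ-Literals.number

  ℚ-number : Number ℚ
  ℚ-number = ℚ-Literals.number

ℚ-ring : AlmostCommutativeRing 0ℓ 0ℓ
ℚ-ring = fromCommutativeRing +-*-commutativeRing (λ p → dec⇒maybe (0ℚ ≟ p))

variable
  p q r u v x y : ℚ

infixl 6 _⊕_
infixl 7 _⊗_

_⊕_ : 0ℚ ≤ p → 0ℚ ≤ q → 0ℚ ≤ p + q
_⊕_ = +-mono-≤

_⊗_ : 0ℚ ≤ p → 0ℚ ≤ q → 0ℚ ≤ p * q
_⊗_ {p} {q} 0≤p 0≤q = subst (_≤ p * q) (*-zeroʳ p) (*-monoˡ-≤-nonNeg p {{nonNegative 0≤p}} 0≤q)

p≤q⇒0≤q-p : p ≤ q → 0ℚ ≤ q - p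
p≤q⇒0≤q-p {p} {q} p≤q = subst (_≤ q - p) (+-inverseʳ p) (+-monoˡ-≤ (- p) p≤q)

p≤∣p∣ : ∀ p → p ≤ ∣ p ∣
p≤∣p∣ p with ≤-total 0ℚ p
... | inj₁ 0≤p = ≤-reflexive (sym (0≤p⇒∣p∣≡p 0≤p))
... | inj₂ p≤0 = ≤-trans p≤0 (0≤∣p∣ p)

-p≤∣p∣ : ∀ p → - p ≤ ∣ p ∣
-p≤∣p∣ p = subst (- p ≤_) (∣-p∣≡∣p∣ p) (p≤∣p∣ (- p))

≤-by-certificate : ∀ e → 0ℚ ≤ e → p + e ≡ q → p ≤ q
≤-by-certificate {p} e 0≤e refl = subst (_≤ p + e) (+-identityʳ p) (+-monoʳ-≤ p 0≤e)

<-by-certificate : ∀ e → 0ℚ < e → p + e ≡ q → p < q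
<-by-certificate {p} e 0<e refl = subst (_< p + e) (+-identityʳ p) (+-monoʳ-< p 0<e)

≡-modulo : ∀ c → u ≡ v → p ≡ q + c * (u - v) → p ≡ q
≡-modulo {u} {q = q} c refl p≡q+c[u-u] = trans p≡q+c[u-u] (solve (q ∷ c ∷ u ∷ []) ℚ-ring)

p≤q⇒[p-q]*x≤y : p ≤ q → 0ℚ ≤ x → 0ℚ ≤ y → (p - q) * x ≤ y
p≤q⇒[p-q]*x≤y {p} {q} {x} {y} p≤q 0≤x 0≤y =
  ≤-by-certificate ((q - p) * x + y) (p≤q⇒0≤q-p p≤q ⊗ 0≤x ⊕ 0≤y) (solve (p ∷ q ∷ x ∷ y ∷ []) ℚ-ring)

p³≤q³⇒p≤q : 0ℚ ≤ q → p * p * p ≤ q * q * q → p ≤ q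
p³≤q³⇒p≤q {q} {p} 0≤q p³≤q³ with p ≤? q
... | yes p≤q = p≤q
... | no  p≰q = ⊥-elim (<-irrefl refl (<-≤-trans q³<p³ p³≤q³))
  where
  pos*pos : 0ℚ < u → 0ℚ < v → 0ℚ < u * v
  pos*pos {u} {v} 0<u 0<v = positive⁻¹ (u * v) {{pos*pos⇒pos u {{positive 0<u}} v {{positive 0<v}}}}
  q<p : q < p
  q<p = ≰⇒> p≰q
  0<p : 0ℚ < p
  0<p = ≤-<-trans 0≤q q<p
  0<p-q : 0ℚ < p - q
  0<p-q = subst (_< p - q) (+-inverseʳ q) (+-monoˡ-< (- q) q<p)
  0<p²+pq+q² : 0ℚ < p * p + p * q + q * q
  0<p²+pq+q² = +-mono-<-≤ (+-mono-<-≤ (pos*pos 0<p 0<p) (<⇒≤ 0<p ⊗ 0≤q)) (0≤q ⊗ 0≤q)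
  q³<p³ : q * q * q < p * p * p
  q³<p³ = <-by-certificate ((p - q) * (p * p + p * q + q * q)) (pos*pos 0<p-q 0<p²+pq+q²)
            (solve (p ∷ q ∷ []) ℚ-ring)

pow-2 : ∀ p → pow p 2 ≡ p * p
pow-2 p = cong (p *_) (*-identityʳ p)

pow-3 : ∀ p → pow p 3 ≡ p * p * p
pow-3 p = trans (cong (λ s → p * (p * s)) (*-identityʳ p)) (sym (*-assoc p p p))

ιℕ-nonNeg : ∀ m → 0ℚ ≤ ιℕ m
ιℕ-nonNeg m = nonNegative⁻¹ (ιℕ m) {{normalize-nonNeg m 1}}

ιℕ-+ : ∀ m n → ιℕ (m ℕ.+ n) ≡ ιℕ m + ιℕ n
ιℕ-+ m n = toℚᵘ-injective (begin
  toℚᵘ (ιℕ (m ℕ.+ n))                ≈⟨ toℚᵘ-fromℚᵘ (mkℚᵘ (ℤ.+ m ℤ.+ ℤ.+ n) 0) ⟩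
  mkℚᵘ (ℤ.+ m ℤ.+ ℤ.+ n) 0            ≈⟨ *≡* (cross-multiplied (ℤ.+ m) (ℤ.+ n)) ⟩
  mkℚᵘ (ℤ.+ m) 0 ℚᵘ.+ mkℚᵘ (ℤ.+ n) 0  ≈⟨ ℚᵘ.+-cong (toℚᵘ-fromℚᵘ (mkℚᵘ (ℤ.+ m) 0)) (toℚᵘ-fromℚᵘ (mkℚᵘ (ℤ.+ n) 0)) ⟨
  toℚᵘ (ιℕ m) ℚᵘ.+ toℚᵘ (ιℕ n)        ≈⟨ toℚᵘ-homo-+ (ιℕ m) (ιℕ n) ⟨
  toℚᵘ (ιℕ m + ιℕ n)                  ∎)
  where
  open ≃-Reasoning
  cross-multiplied : ∀ i j → (i ℤ.+ j) ℤ.* ℤ.+ 1 ≡ (i ℤ.* ℤ.+ 1 ℤ.+ j ℤ.* ℤ.+ 1) ℤ.* ℤ.+ 1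
  cross-multiplied = ℤ-Solver.solve-∀

ιℕ-suc : ∀ m → ιℕ (suc m) ≡ 1ℚ + ιℕ m
ιℕ-suc = ιℕ-+ 1

ιℕ-mono-≤ : ∀ {m n} → m ℕ.≤ n → ιℕ m ≤ ιℕ n
ιℕ-mono-≤ {m} {n} m≤n = subst (λ k → ιℕ m ≤ ιℕ k) (m+[n∸m]≡n m≤n)
  (≤-by-certificate (ιℕ (n ℕ.∸ m)) (ιℕ-nonNeg (n ℕ.∸ m)) (sym (ιℕ-+ m (n ℕ.∸ m))))

1≤ιℕ[1+t] : ∀ t → 1ℚ ≤ ιℕ (suc t)
1≤ιℕ[1+t] t = ιℕ-mono-≤ {1} {suc t} (ℕ.s≤s ℕ.z≤n)

W : ℕ → ℚ → ℚ
W t r = M t r + Z t r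

P : ℕ → ℚ → ℚ
P t r = sumBelow t (λ j → W j r)

sumBelow-nonNeg : ∀ {f} m → (∀ j → 0ℚ ≤ f j) → 0ℚ ≤ sumBelow m f
sumBelow-nonNeg zero    0≤f = ≤-refl
sumBelow-nonNeg (suc m) 0≤f = sumBelow-nonNeg m 0≤f ⊕ 0≤f m

pow-nonNeg : 0ℚ ≤ r → ∀ j → 0ℚ ≤ pow r j
pow-nonNeg 0≤r zero    = nonNegative⁻¹ 1ℚ
pow-nonNeg 0≤r (suc j) = 0≤r ⊗ pow-nonNeg 0≤r j

Z-nonNeg : 0ℚ ≤ r → ∀ t → 0ℚ ≤ Z t r
Z-nonNeg 0≤r t = sumBelow-nonNeg t (pow-nonNeg 0≤r)

W-nonNeg : 0ℚ ≤ r → ∀ t → 0ℚ ≤ W t r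
W-nonNeg 0≤r t = sumBelow-nonNeg t (λ j → ιℕ-nonNeg j ⊗ pow-nonNeg 0≤r j) ⊕ Z-nonNeg 0≤r t

P-nonNeg : 0ℚ ≤ r → ∀ t → 0ℚ ≤ P t r
P-nonNeg 0≤r t = sumBelow-nonNeg t (W-nonNeg 0≤r)

1≤P[2+t] : 0ℚ ≤ r → ∀ t → 1ℚ ≤ P (2 ℕ.+ t) r
1≤P[2+t] 0≤r zero    = ≤-refl
1≤P[2+t] 0≤r (suc t) = ≤-trans (1≤P[2+t] 0≤r t) (≤-by-certificate _ (W-nonNeg 0≤r (2 ℕ.+ t)) refl)

Z₂≡1+r : ∀ r → Z 2 r ≡ 1ℚ + r
Z₂≡1+r r = cong (1ℚ +_) (*-identityʳ r)

-- In each inductive step the ring solver needs M t r, Z t r, … as variables,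
-- so the step is stated over fresh ones.
[r-1]*W≡t*rᵗ-Z : ∀ t r → (r - 1ℚ) * W t r ≡ ιℕ t * pow r t - Z t r
[r-1]*W≡t*rᵗ-Z zero    r = *-zeroʳ (r - 1ℚ)
[r-1]*W≡t*rᵗ-Z (suc t) r rewrite ιℕ-suc t =
  step (ιℕ t) (M t r) (Z t r) (pow r t) ([r-1]*W≡t*rᵗ-Z t r)
  where
  step : ∀ T m z ρ → (r - 1ℚ) * (m + z) ≡ T * ρ - z →
         (r - 1ℚ) * ((m + T * ρ) + (z + ρ)) ≡ (1ℚ + T) * (r * ρ) - (z + ρ)
  step T m z ρ ih = ≡-modulo 1ℚ ih (solve (r ∷ T ∷ m ∷ z ∷ ρ ∷ []) ℚ-ring)

[r-1]*P≡2M-[t-1]*Z : ∀ t r → (r - 1ℚ) * P t r ≡ 2 * M t r - (ιℕ t - 1ℚ) * Z t r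
[r-1]*P≡2M-[t-1]*Z zero    r = *-zeroʳ (r - 1ℚ)
[r-1]*P≡2M-[t-1]*Z (suc t) r rewrite ιℕ-suc t =
  step (ιℕ t) (M t r) (Z t r) (pow r t) (P t r) ([r-1]*P≡2M-[t-1]*Z t r) ([r-1]*W≡t*rᵗ-Z t r)
  where
  step : ∀ T m z ρ w → (r - 1ℚ) * w ≡ 2 * m - (T - 1ℚ) * z → (r - 1ℚ) * (m + z) ≡ T * ρ - z →
         (r - 1ℚ) * (w + (m + z)) ≡ 2 * (m + T * ρ) - ((1ℚ + T) - 1ℚ) * (z + ρ)
  step T m z ρ w ih W-id =
    ≡-modulo 1ℚ ih (≡-modulo 1ℚ W-id (solve (r ∷ T ∷ m ∷ z ∷ ρ ∷ w ∷ []) ℚ-ring))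

t[t+1]rᵗ≤2W : 0ℚ ≤ r → r ≤ 1ℚ → ∀ t → ιℕ t * (ιℕ t + 1ℚ) * pow r t ≤ 2 * W t r
t[t+1]rᵗ≤2W 0≤r r≤1 zero    = ≤-refl
t[t+1]rᵗ≤2W {r} 0≤r r≤1 (suc t) rewrite ιℕ-suc t =
  step (ιℕ t) (M t r) (Z t r) (pow r t) (ιℕ-nonNeg t) (pow-nonNeg 0≤r t) (t[t+1]rᵗ≤2W 0≤r r≤1 t)
  where
  step : ∀ T m z ρ → 0ℚ ≤ T → 0ℚ ≤ ρ → T * (T + 1ℚ) * ρ ≤ 2 * (m + z) →
         (1ℚ + T) * ((1ℚ + T) + 1ℚ) * (r * ρ) ≤ 2 * ((m + T * ρ) + (z + ρ))
  step T m z ρ 0≤T 0≤ρ ih =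
    ≤-by-certificate ((2 * (m + z) - T * (T + 1ℚ) * ρ) + (T + 1ℚ) * (T + 2) * (1ℚ - r) * ρ)
      (p≤q⇒0≤q-p ih ⊕ (0≤T ⊕ nonNegative⁻¹ 1ℚ) ⊗ (0≤T ⊕ nonNegative⁻¹ 2) ⊗ p≤q⇒0≤q-p r≤1 ⊗ 0≤ρ)
      (solve (r ∷ T ∷ m ∷ z ∷ ρ ∷ []) ℚ-ring)

t²Z≤8[1+dt]P-step : ∀ {d T z ρ w W} →
  T * T * z ≤ 8 * (1ℚ + d * T) * w →
  (2 * T + 1ℚ) * z + (1ℚ + T) * (1ℚ + T) * ρ ≤ 8 * d * w + 8 * (1ℚ + d * (1ℚ + T)) * W →
  (1ℚ + T) * (1ℚ + T) * (z + ρ) ≤ 8 * (1ℚ + d * (1ℚ + T)) * (w + W)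
t²Z≤8[1+dt]P-step {d} {T} {z} {ρ} {w} {W} ih increment = begin
  (1ℚ + T) * (1ℚ + T) * (z + ρ)
    ≡⟨ solve (T ∷ z ∷ ρ ∷ []) ℚ-ring ⟩
  T * T * z + ((2 * T + 1ℚ) * z + (1ℚ + T) * (1ℚ + T) * ρ)
    ≤⟨ +-mono-≤ ih increment ⟩
  8 * (1ℚ + d * T) * w + (8 * d * w + 8 * (1ℚ + d * (1ℚ + T)) * W)
    ≡⟨ solve (d ∷ T ∷ w ∷ W ∷ []) ℚ-ring ⟩
  8 * (1ℚ + d * (1ℚ + T)) * (w + W) ∎
  where open ≤-Reasoning

-- For r ≥ 1 the identities exhibit t rᵗ - Z and 2W - (t+1)Z as the nonnegative
-- quantities (r-1)W and (r-1)P; the certificate is written in terms of these.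
increment-bound-r≥1 : ∀ {T m z ρ w} → 1ℚ ≤ r → 1ℚ ≤ T → 0ℚ ≤ m + z → 0ℚ ≤ ρ → 0ℚ ≤ w →
  (r - 1ℚ) * (m + z) ≡ T * ρ - z → (r - 1ℚ) * w ≡ 2 * m - (T - 1ℚ) * z →
  (2 * T + 1ℚ) * z + (1ℚ + T) * (1ℚ + T) * ρ ≤ 8 * (r - 1ℚ) * w + 8 * (1ℚ + (r - 1ℚ) * (1ℚ + T)) * (m + z)
increment-bound-r≥1 {r} {T} {m} {z} {ρ} {w} 1≤r 1≤T 0≤m+z 0≤ρ 0≤w W-id P-id =
  ≤-by-certificate
    (12 * (r - 1ℚ) * w + (6 * T + 5) * ((r - 1ℚ) * (m + z)) + ((T - 1ℚ) * (T + 2) + 1ℚ) * ρ)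
    ( nonNegative⁻¹ 12 ⊗ 0≤r-1 ⊗ 0≤w
    ⊕ (nonNegative⁻¹ 6 ⊗ 0≤T ⊕ nonNegative⁻¹ 5) ⊗ (0≤r-1 ⊗ 0≤m+z)
    ⊕ (p≤q⇒0≤q-p 1≤T ⊗ (0≤T ⊕ nonNegative⁻¹ 2) ⊕ nonNegative⁻¹ 1ℚ) ⊗ 0≤ρ)
    (≡-modulo (2 * T + 3) (sym W-id) (≡-modulo 4 P-id (solve (r ∷ T ∷ m ∷ z ∷ ρ ∷ w ∷ []) ℚ-ring)))
  where
  0≤r-1 : 0ℚ ≤ r - 1ℚ
  0≤r-1 = p≤q⇒0≤q-p 1≤r
  0≤T : 0ℚ ≤ T
  0≤T = ≤-trans (nonNegative⁻¹ 1ℚ) 1≤T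

-- For r ≤ 1 the powers decrease, so t rᵗ ≤ Z (that is, (1-r)W ≥ 0) and t(t+1) rᵗ ≤ 2W.
increment-bound-r≤1 : ∀ {T m z ρ w} → r ≤ 1ℚ → 1ℚ ≤ T → 0ℚ ≤ m + z → 0ℚ ≤ ρ → 0ℚ ≤ w →
  (r - 1ℚ) * (m + z) ≡ T * ρ - z → T * (T + 1ℚ) * ρ ≤ 2 * (m + z) →
  (2 * T + 1ℚ) * z + (1ℚ + T) * (1ℚ + T) * ρ ≤ 8 * (1ℚ - r) * w + 8 * (1ℚ + (1ℚ - r) * (1ℚ + T)) * (m + z)
increment-bound-r≤1 {r} {T} {m} {z} {ρ} {w} r≤1 1≤T 0≤m+z 0≤ρ 0≤w W-id t[t+1]ρ≤2W =
  ≤-by-certificate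
    ( 8 * (1ℚ - r) * w + 4 * (2 * (m + z) - T * (T + 1ℚ) * ρ)
    + (6 * T + 7) * ((1ℚ - r) * (m + z)) + ((T - 1ℚ) * (T + 2) + 1ℚ) * ρ)
    ( nonNegative⁻¹ 8 ⊗ 0≤1-r ⊗ 0≤w ⊕ nonNegative⁻¹ 4 ⊗ p≤q⇒0≤q-p t[t+1]ρ≤2W
    ⊕ (nonNegative⁻¹ 6 ⊗ 0≤T ⊕ nonNegative⁻¹ 7) ⊗ (0≤1-r ⊗ 0≤m+z)
    ⊕ (p≤q⇒0≤q-p 1≤T ⊗ (0≤T ⊕ nonNegative⁻¹ 2) ⊕ nonNegative⁻¹ 1ℚ) ⊗ 0≤ρ)
    (≡-modulo (2 * T + 1) W-id (solve (r ∷ T ∷ m ∷ z ∷ ρ ∷ w ∷ []) ℚ-ring))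
  where
  0≤1-r : 0ℚ ≤ 1ℚ - r
  0≤1-r = p≤q⇒0≤q-p r≤1
  0≤T : 0ℚ ≤ T
  0≤T = ≤-trans (nonNegative⁻¹ 1ℚ) 1≤T

t²Z≤8[1+[r-1]t]P : 1ℚ ≤ r → ∀ t →
  ιℕ (2 ℕ.+ t) * ιℕ (2 ℕ.+ t) * Z (2 ℕ.+ t) r ≤ 8 * (1ℚ + (r - 1ℚ) * ιℕ (2 ℕ.+ t)) * P (2 ℕ.+ t) r
t²Z≤8[1+[r-1]t]P {r} 1≤r zero =
  subst (λ z → 4 * z ≤ 8 * (1ℚ + (r - 1ℚ) * 2) * 1ℚ) (sym (Z₂≡1+r r))
    (≤-by-certificate (12 * (r - 1ℚ)) (nonNegative⁻¹ 12 ⊗ p≤q⇒0≤q-p 1≤r) (solve (r ∷ []) ℚ-ring))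
t²Z≤8[1+[r-1]t]P {r} 1≤r (suc t) rewrite ιℕ-suc (2 ℕ.+ t) =
  t²Z≤8[1+dt]P-step {d = r - 1ℚ} {T = ιℕ (2 ℕ.+ t)} (t²Z≤8[1+[r-1]t]P 1≤r t)
    (increment-bound-r≥1 {T = ιℕ (2 ℕ.+ t)} {M (2 ℕ.+ t) r} {Z (2 ℕ.+ t) r} {pow r (2 ℕ.+ t)} {P (2 ℕ.+ t) r}
      1≤r (1≤ιℕ[1+t] (suc t)) (W-nonNeg 0≤r (2 ℕ.+ t)) (pow-nonNeg 0≤r (2 ℕ.+ t)) (P-nonNeg 0≤r (2 ℕ.+ t))
      ([r-1]*W≡t*rᵗ-Z (2 ℕ.+ t) r) ([r-1]*P≡2M-[t-1]*Z (2 ℕ.+ t) r))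
  where
  0≤r : 0ℚ ≤ r
  0≤r = ≤-trans (nonNegative⁻¹ 1ℚ) 1≤r

t²Z≤8[1+[1-r]t]P : 0ℚ ≤ r → r ≤ 1ℚ → ∀ t →
  ιℕ (2 ℕ.+ t) * ιℕ (2 ℕ.+ t) * Z (2 ℕ.+ t) r ≤ 8 * (1ℚ + (1ℚ - r) * ιℕ (2 ℕ.+ t)) * P (2 ℕ.+ t) r
t²Z≤8[1+[1-r]t]P {r} 0≤r r≤1 zero =
  subst (λ z → 4 * z ≤ 8 * (1ℚ + (1ℚ - r) * 2) * 1ℚ) (sym (Z₂≡1+r r))
    (≤-by-certificate (20 * (1ℚ - r)) (nonNegative⁻¹ 20 ⊗ p≤q⇒0≤q-p r≤1) (solve (r ∷ []) ℚ-ring))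
t²Z≤8[1+[1-r]t]P {r} 0≤r r≤1 (suc t) rewrite ιℕ-suc (2 ℕ.+ t) =
  t²Z≤8[1+dt]P-step {d = 1ℚ - r} {T = ιℕ (2 ℕ.+ t)} (t²Z≤8[1+[1-r]t]P 0≤r r≤1 t)
    (increment-bound-r≤1 {T = ιℕ (2 ℕ.+ t)} {M (2 ℕ.+ t) r} {Z (2 ℕ.+ t) r} {pow r (2 ℕ.+ t)} {P (2 ℕ.+ t) r}
      r≤1 (1≤ιℕ[1+t] (suc t)) (W-nonNeg 0≤r (2 ℕ.+ t)) (pow-nonNeg 0≤r (2 ℕ.+ t)) (P-nonNeg 0≤r (2 ℕ.+ t))
      ([r-1]*W≡t*rᵗ-Z (2 ℕ.+ t) r) (t[t+1]rᵗ≤2W 0≤r r≤1 (2 ℕ.+ t)))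

μ≤⇒n[r-1]P≤2∣q∣Z : ∀ {t n k} → 0ℚ ≤ r → μ≤ t n k r →
  ιℕ n * ((r - 1ℚ) * P t r) ≤ 2 * ∣ qval t n k ∣ * Z t r
μ≤⇒n[r-1]P≤2∣q∣Z {r} {t} {n} {k} 0≤r nM≤kZ =
  bound (ιℕ n) (ιℤ k) (ιℕ t) (M t r) (Z t r) (P t r) ∣ qval t n k ∣
    ([r-1]*P≡2M-[t-1]*Z t r) nM≤kZ (Z-nonNeg 0≤r t) (-p≤∣p∣ (qval t n k))
  where
  bound : ∀ N K T m z w Q → (r - 1ℚ) * w ≡ 2 * m - (T - 1ℚ) * z → N * m ≤ K * z → 0ℚ ≤ z →
          - ((T - 1ℚ) * N * ½ - K) ≤ Q → N * ((r - 1ℚ) * w) ≤ 2 * Q * z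
  bound N K T m z w Q P-id nm≤kz 0≤z -q≤Q =
    ≤-by-certificate (2 * (K * z - N * m) + 2 * z * (Q - - ((T - 1ℚ) * N * ½ - K)))
      (nonNegative⁻¹ 2 ⊗ p≤q⇒0≤q-p nm≤kz ⊕ nonNegative⁻¹ 2 ⊗ 0≤z ⊗ p≤q⇒0≤q-p -q≤Q)
      (≡-modulo N P-id (solve (r ∷ N ∷ K ∷ T ∷ m ∷ z ∷ w ∷ Q ∷ []) ℚ-ring))

μ≥⇒n[1-r]P≤2∣q∣Z : ∀ {t n k} → 0ℚ ≤ r → μ≥ t n k r →
  ιℕ n * ((1ℚ - r) * P t r) ≤ 2 * ∣ qval t n k ∣ * Z t r
μ≥⇒n[1-r]P≤2∣q∣Z {r} {t} {n} {k} 0≤r kZ≤nM =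
  bound (ιℕ n) (ιℤ k) (ιℕ t) (M t r) (Z t r) (P t r) ∣ qval t n k ∣
    ([r-1]*P≡2M-[t-1]*Z t r) kZ≤nM (Z-nonNeg 0≤r t) (p≤∣p∣ (qval t n k))
  where
  bound : ∀ N K T m z w Q → (r - 1ℚ) * w ≡ 2 * m - (T - 1ℚ) * z → K * z ≤ N * m → 0ℚ ≤ z →
          (T - 1ℚ) * N * ½ - K ≤ Q → N * ((1ℚ - r) * w) ≤ 2 * Q * z
  bound N K T m z w Q P-id kz≤nm 0≤z q≤Q =
    ≤-by-certificate (2 * (N * m - K * z) + 2 * z * (Q - ((T - 1ℚ) * N * ½ - K)))
      (nonNegative⁻¹ 2 ⊗ p≤q⇒0≤q-p kz≤nm ⊕ nonNegative⁻¹ 2 ⊗ 0≤z ⊗ p≤q⇒0≤q-p q≤Q)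
      (≡-modulo N (sym P-id) (solve (r ∷ N ∷ K ∷ T ∷ m ∷ z ∷ w ∷ Q ∷ []) ℚ-ring))

c∣q∣≤nt : ∀ {c Q T N} → 0ℚ ≤ c → 0ℚ ≤ T → c * c * c ≤ N → pow Q 3 ≤ pow T 3 * pow N 2 →
          c * Q ≤ N * T
c∣q∣≤nt {c} {Q} {T} {N} 0≤c 0≤T c³≤N Q³≤T³N² =
  p³≤q³⇒p≤q (0≤N ⊗ 0≤T)
    (≤-by-certificate (c * c * c * (T * T * T * (N * N) - Q * Q * Q) + (N - c * c * c) * (T * T * T * (N * N)))
      (0≤c ⊗ 0≤c ⊗ 0≤c ⊗ p≤q⇒0≤q-p Q³≤T³N²′ ⊕ p≤q⇒0≤q-p c³≤N ⊗ (0≤T ⊗ 0≤T ⊗ 0≤T ⊗ (0≤N ⊗ 0≤N)))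
      (solve (c ∷ Q ∷ T ∷ N ∷ []) ℚ-ring))
  where
  0≤N : 0ℚ ≤ N
  0≤N = ≤-trans (0≤c ⊗ 0≤c ⊗ 0≤c) c³≤N
  Q³≤T³N²′ : Q * Q * Q ≤ T * T * T * (N * N)
  Q³≤T³N²′ = subst₂ _≤_ (pow-3 Q) (cong₂ _*_ (pow-3 T) (pow-2 N)) Q³≤T³N²

dt²n≤32∣q∣ : ∀ {d T N Q z w} → 0ℚ ≤ d → 0ℚ ≤ T → 0ℚ ≤ Q → 1ℚ ≤ w →
  N * (d * w) ≤ 2 * Q * z → T * T * z ≤ 8 * (1ℚ + d * T) * w → 32 * Q ≤ N * T →
  d * (pow T 2 * N) ≤ 32 * Q
dt²n≤32∣q∣ {d} {T} {N} {Q} {z} {w} 0≤d 0≤T 0≤Q 1≤w moment-bound t²Z-bound 32Q≤NT =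
  subst (λ s → d * (s * N) ≤ 32 * Q) (sym (pow-2 T))
    (*-cancelʳ-≤-pos w {{positive 0<w}}
      (≤-by-certificate
        ( 2 * (T * T) * (2 * Q * z - N * (d * w)) + 4 * Q * (8 * (1ℚ + d * T) * w - T * T * z)
        + d * T * w * (N * T - 32 * Q))
        ( nonNegative⁻¹ 2 ⊗ (0≤T ⊗ 0≤T) ⊗ p≤q⇒0≤q-p moment-bound
        ⊕ nonNegative⁻¹ 4 ⊗ 0≤Q ⊗ p≤q⇒0≤q-p t²Z-bound
        ⊕ 0≤d ⊗ 0≤T ⊗ <⇒≤ 0<w ⊗ p≤q⇒0≤q-p 32Q≤NT)
        (solve (d ∷ T ∷ N ∷ Q ∷ z ∷ w ∷ []) ℚ-ring)))
  where
  0<w : 0ℚ < w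
  0<w = <-≤-trans (positive⁻¹ 1ℚ) 1≤w

μ≤⇒[r-1]t²n≤32∣q∣ : ∀ n t k → 32 * ∣ qval (2 ℕ.+ t) n k ∣ ≤ ιℕ n * ιℕ (2 ℕ.+ t) →
  (r : ℚ) → 0ℚ ≤ r → μ≤ (2 ℕ.+ t) n k r →
  (r - 1ℚ) * (pow (ιℕ (2 ℕ.+ t)) 2 * ιℕ n) ≤ 32 * ∣ qval (2 ℕ.+ t) n k ∣
μ≤⇒[r-1]t²n≤32∣q∣ n t k 32∣q∣≤nt r 0≤r μ≤k/n with ≤-total r 1ℚ
... | inj₁ r≤1 = p≤q⇒[p-q]*x≤y r≤1 (pow-nonNeg (ιℕ-nonNeg (2 ℕ.+ t)) 2 ⊗ ιℕ-nonNeg n)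
                   (nonNegative⁻¹ 32 ⊗ 0≤∣p∣ (qval (2 ℕ.+ t) n k))
... | inj₂ 1≤r = dt²n≤32∣q∣ (p≤q⇒0≤q-p 1≤r) (ιℕ-nonNeg (2 ℕ.+ t)) (0≤∣p∣ (qval (2 ℕ.+ t) n k))
                   (1≤P[2+t] 0≤r t) (μ≤⇒n[r-1]P≤2∣q∣Z {t = 2 ℕ.+ t} {n} {k} 0≤r μ≤k/n)
                   (t²Z≤8[1+[r-1]t]P 1≤r t) 32∣q∣≤nt

μ≥⇒[1-r]t²n≤32∣q∣ : ∀ n t k → 32 * ∣ qval (2 ℕ.+ t) n k ∣ ≤ ιℕ n * ιℕ (2 ℕ.+ t) →
  (r : ℚ) → 0ℚ ≤ r → μ≥ (2 ℕ.+ t) n k r →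
  (1ℚ - r) * (pow (ιℕ (2 ℕ.+ t)) 2 * ιℕ n) ≤ 32 * ∣ qval (2 ℕ.+ t) n k ∣
μ≥⇒[1-r]t²n≤32∣q∣ n t k 32∣q∣≤nt r 0≤r μ≥k/n with ≤-total r 1ℚ
... | inj₂ 1≤r = p≤q⇒[p-q]*x≤y 1≤r (pow-nonNeg (ιℕ-nonNeg (2 ℕ.+ t)) 2 ⊗ ιℕ-nonNeg n)
                   (nonNegative⁻¹ 32 ⊗ 0≤∣p∣ (qval (2 ℕ.+ t) n k))
... | inj₁ r≤1 = dt²n≤32∣q∣ (p≤q⇒0≤q-p r≤1) (ιℕ-nonNeg (2 ℕ.+ t)) (0≤∣p∣ (qval (2 ℕ.+ t) n k))
                   (1≤P[2+t] 0≤r t) (μ≥⇒n[1-r]P≤2∣q∣Z {t = 2 ℕ.+ t} {n} {k} 0≤r μ≥k/n)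
                   (t²Z≤8[1+[1-r]t]P 0≤r r≤1 t) 32∣q∣≤nt

lemma3p3 : Σ ℚ λ C → Σ ℕ λ n₀ → (0ℚ < C) ×
    ((n t : ℕ) → n ≥ℕ n₀ → t ≥ℕ 2 → (k : ℤ) →
      pow ∣ qval t n k ∣ 3 ≤ pow (ιℕ t) 3 * pow (ιℕ n) 2 →
      ((r : ℚ) → 0ℚ ≤ r → μ≤ t n k r →
          (r - 1ℚ) * (pow (ιℕ t) 2 * ιℕ n) ≤ C * ∣ qval t n k ∣) ×
      ((r : ℚ) → 0ℚ ≤ r → μ≥ t n k r →
          (1ℚ - r) * (pow (ιℕ t) 2 * ιℕ n) ≤ C * ∣ qval t n k ∣))
lemma3p3 = 32 , 32768 , positive⁻¹ 32 , λ where
  n (suc (suc t)) n≥32³ _ k q³≤t³n² →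
    let 32∣q∣≤nt = c∣q∣≤nt {Q = ∣ qval (2 ℕ.+ t) n k ∣} (nonNegative⁻¹ 32) (ιℕ-nonNeg (2 ℕ.+ t))
                     (ιℕ-mono-≤ {32768} {n} n≥32³) q³≤t³n²
    in μ≤⇒[r-1]t²n≤32∣q∣ n t k 32∣q∣≤nt , μ≥⇒[1-r]t²n≤32∣q∣ n t k 32∣q∣≤nt
  _ 0 _ ()
  _ 1 _ (ℕ.s≤s ())
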